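{- Let $p$ be a prime, $q=p^e$, and let $n$ be a positive divisor of $q-1$ such that $n$ is even if $p>2$, $e$ is the multiplicative order of $p$ modulo $n$, and $(q-1)/(p-1)$ divides $n$. Let $S$ be the subgroup of order $n$ of $F_q^*$ and let $H_0$ be the group of permutations $v\mapsto av^{\gamma}$ of $F_q$ with $a\in S$ and $\gamma\in\mathrm{Gal}(F_q/F_p)$. Let $D\le H_0$ be the cyclic subgroup of order $n$ consisting of the maps $v\mapsto av$ with $a\in S$. Then the only elements of order $n$ in $H_0$ are the generators of $D$. -}

module Defs where

open import Level using (Level; _⊔_; 0ℓ)
open import Algebra.Bundles using (CommutativeRing; Semiring)
open import Data.Nat as ℕ using (ℕ; zero; suc; NonZero; _<_; _∸_)
open import Data.Nat.Divisibility using (_∣_)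
open import Data.Nat.Primality using (Prime)
open import Data.Fin using (Fin)
open import Data.Product using (∃; ∃₂; _×_; _,_)
open import Relation.Nullary using (¬_)
open import Relation.Binary.PropositionalEquality as P using (_≡_)
open import Function.Bundles using (Inverse)
import Algebra.Definitions.RawSemiring as RawSR

record IsField {c ℓ : Level} (R : CommutativeRing c ℓ) : Set (c ⊔ ℓ) where
  open CommutativeRing R
  field
    0≉1     : ¬ (0# ≈ 1#)
    inverse : ∀ x → ¬ (x ≈ 0#) → ∃ λ y → (x * y) ≈ 1#

HasCard : {c ℓ : Level} → CommutativeRing c ℓ → ℕ → Set (c ⊔ ℓ)
HasCard R q = Inverse (CommutativeRing.setoid R) (P.setoid (Fin q))

prime⇒pred-nonZero : ∀ {p} → Prime p → NonZero (p ∸ 1)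
prime⇒pred-nonZero {suc (suc k)} _ = _

-- e is the multiplicative order of p modulo n:
-- p^e ≡ 1 (mod n) with e > 0 minimal.  (p^k ≥ 1, so "n ∣ p^k ∸ 1" is p^k ≡ 1 mod n.)
MultOrder : ℕ → ℕ → ℕ → Set
MultOrder p n e =
  (0 < e) × (n ∣ (p ℕ.^ e) ∸ 1) × (∀ k → 0 < k → k < e → ¬ (n ∣ (p ℕ.^ k) ∸ 1))

iter : {c : Level} → {B : Set c} → (B → B) → ℕ → B → B
iter f zero    v = v
iter f (suc k) v = f (iter f k v)

module FieldDefs {c ℓ : Level} (F : CommutativeRing c ℓ) where
  open CommutativeRing F
  open RawSR (Semiring.rawSemiring (CommutativeRing.semiring F)) using (_^_)

  _≋_ : (Carrier → Carrier) → (Carrier → Carrier) → Set (c ⊔ ℓ)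
  f ≋ g = ∀ v → f v ≈ g v

  HasOrder : (Carrier → Carrier) → ℕ → Set (c ⊔ ℓ)
  HasOrder g n = (0 < n) × (iter g n ≋ (λ v → v))
               × (∀ k → 0 < k → k < n → ¬ (iter g k ≋ (λ v → v)))

  -- S: the subgroup of order n of F*, i.e. the n-th roots of unity (n ∣ q - 1)
  InS : ℕ → Carrier → Set ℓ
  InS n a = (a ^ n) ≈ 1#

  -- Gal(F_q/F_p) = { v ↦ v^(p^i) : 0 ≤ i < e }; H₀ element v ↦ a · v^(p^i)
  H0map : ℕ → Carrier → ℕ → Carrier → Carrier
  H0map p a i v = a * (v ^ (p ℕ.^ i))

  InH0 : ℕ → ℕ → ℕ → (Carrier → Carrier) → Set (c ⊔ ℓ)
  InH0 p e n g = ∃₂ λ a i → InS n a × (i < e) × (g ≋ H0map p a i)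

  InD : ℕ → (Carrier → Carrier) → Set (c ⊔ ℓ)
  InD n g = ∃ λ a → InS n a × (g ≋ (λ v → a * v))

  GeneratesD : ℕ → (Carrier → Carrier) → Set (c ⊔ ℓ)
  GeneratesD n g = InD n g × (∀ h → InD n h → ∃ λ k → h ≋ iter g k)

{-# OPTIONS --safe #-}

-- Write g = v ↦ a v^(p^i) with a ∈ S and 0 ≤ i < e.
-- If i = 0, g is multiplication by a, so a has order n.  Then a generates S: an n-th root of unity
-- outside ⟨a⟩ would make the power sums force n · 1 = 0 in F, impossible since n ∣ q − 1.  Hence g generates D.
-- If i > 0, put t = gcd(i, e), d = e / t, r = p^t.  Then g^d is multiplication by a^N with
-- N = 1 + p^i + ⋯ + p^(i(d−1)), and M = 1 + r + ⋯ + r^(d−1) divides both N (as i / t is coprime to d)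
-- and (q − 1)/(p − 1), hence n = s M.  So g^(s d) = id with 0 < s d < s M = n, contradicting the order of g.

module Submission where

open import Defs
open import Level using (Level)
open import Algebra.Bundles using (CommutativeRing; CommutativeMonoid; Semiring)
import Algebra.Definitions.RawSemiring as RawSemiring
import Algebra.Properties.CommutativeMonoid.Sum as CommutativeMonoidSum
open import Data.Empty using (⊥-elim)
open import Data.Fin as Fin using (Fin; toℕ)
import Data.Fin.Properties as Fin
open import Data.Fin.Permutation using (Permutation)
open import Data.Vec.Functional using (removeAt)
import Data.Nat as ℕ
import Data.Nat.Properties as ℕ
open import Data.Nat.Divisibility using (_∣_; divides)
open import Data.Nat.Primality using (Prime; prime⇒nonTrivial)
open import Data.Product using (∃; _,_)
open import Function.Base using (_∘_)
open import Function.Bundles using (Inverse)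
open import Function.Definitions using (Congruent)
open import Function.Properties.Inverse using (Inverse⇒Injection)
import Function.Construct.Composition as Compose
import Function.Construct.Symmetry as Symmetry
open import Relation.Binary.Definitions using (Decidable)
open import Relation.Binary.PropositionalEquality as ≡ using (_≡_; _≢_)
open import Relation.Nullary using (Dec; yes; no; contradiction)
open import Relation.Nullary.Decidable using (via-injection)

module GeometricSums where

  open import Data.Product using (∃; ∃₂; ∃-syntax; _×_; _,_)
  open import Relation.Binary.PropositionalEquality using (_≡_; refl; sym; trans; cong; subst; subst₂; module ≡-Reasoning)
  open import Data.Nat
  open import Data.Nat.Properties
  open import Data.Nat.Divisibility
  open import Data.Nat.DivMod using (m*n/n≡m)
  open import Data.Nat.GCD using (gcd; gcd[m,n]∣m; gcd[m,n]∣n; gcd-greatest; gcd[m,n]≢0; module Bézout)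
  open import Data.Nat.LCM using (lcm; gcd*lcm; lcm-least)
  open import Data.Nat.Coprimality as Coprime using (Coprime; coprime-Bézout; coprime-/gcd)
  open import Data.Nat.Tactic.RingSolver using (solve-∀)
  open import Data.Sum using (inj₁)

  geometricSum : ℕ → ℕ → ℕ
  geometricSum r zero    = 0
  geometricSum r (suc k) = suc (r * geometricSum r k)

  geometricSum*[r∸1]≡r^k∸1 : ∀ r k → geometricSum r k * (r ∸ 1) ≡ r ^ k ∸ 1
  geometricSum*[r∸1]≡r^k∸1 zero    zero    = refl
  geometricSum*[r∸1]≡r^k∸1 zero    (suc k) = *-zeroʳ (geometricSum 0 (suc k))
  geometricSum*[r∸1]≡r^k∸1 (suc r) k       =
    trans (sym (m+n∸n≡m _ 1)) (cong (_∸ 1) (telescope k))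
    where
    telescope : ∀ k → geometricSum (suc r) k * r + 1 ≡ suc r ^ k
    telescope zero    = refl
    telescope (suc k) = trans (shift r (geometricSum (suc r) k)) (cong (suc r *_) (telescope k))
      where
      shift : ∀ r G → suc (suc r * G) * r + 1 ≡ suc r * (G * r + 1)
      shift = solve-∀

  r∸1∣r^k∸1 : ∀ r k → r ∸ 1 ∣ r ^ k ∸ 1
  r∸1∣r^k∸1 r k = divides (geometricSum r k) (sym (geometricSum*[r∸1]≡r^k∸1 r k))

  r^m∸1∣r^[m*k]∸1 : ∀ r m k → r ^ m ∸ 1 ∣ r ^ (m * k) ∸ 1
  r^m∸1∣r^[m*k]∸1 r m k = subst (λ x → r ^ m ∸ 1 ∣ x ∸ 1) (^-*-assoc r m k) (r∸1∣r^k∸1 (r ^ m) k)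

  ∣x∸1⇒∣r*x∸1⇒∣r∸1 : ∀ {t} r {x} → 1 ≤ x → t ∣ x ∸ 1 → t ∣ r * x ∸ 1 → t ∣ r ∸ 1
  ∣x∸1⇒∣r*x∸1⇒∣r∸1     zero    _ _ _ = _ ∣0
  ∣x∸1⇒∣r*x∸1⇒∣r∸1 {t} (suc r) {suc y} _ t∣y t∣rx =
    ∣m+n∣m⇒∣n (subst (t ∣_) (split r y) t∣rx) (∣n⇒∣m*n (suc r) t∣y)
    where
    split : ∀ r y → y + r * suc y ≡ suc r * y + r
    split = solve-∀

  bézout⇒∣r∸1 : ∀ {t m n x y} r .{{_ : NonZero r}} → 1 + y * n ≡ x * m →
                t ∣ r ^ m ∸ 1 → t ∣ r ^ n ∸ 1 → t ∣ r ∸ 1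
  bézout⇒∣r∸1 {t} {m} {n} {x} {y} r eq t∣m t∣n =
    ∣x∸1⇒∣r*x∸1⇒∣r∸1 r (m^n>0 r (n * y)) (∣-trans t∣n (r^m∸1∣r^[m*k]∸1 r n y))
      (subst (λ k → t ∣ r ^ k ∸ 1) m*x≡1+n*y (∣-trans t∣m (r^m∸1∣r^[m*k]∸1 r m x)))
    where
    m*x≡1+n*y : m * x ≡ suc (n * y)
    m*x≡1+n*y = trans (*-comm m x) (trans (sym eq) (cong suc (*-comm y n)))

  coprime⇒∣r^m∸1⇒∣r^n∸1⇒∣r∸1 : ∀ {t m n} r .{{_ : NonZero r}} → Coprime m n →
                                 t ∣ r ^ m ∸ 1 → t ∣ r ^ n ∸ 1 → t ∣ r ∸ 1
  coprime⇒∣r^m∸1⇒∣r^n∸1⇒∣r∸1 {t} {m} {n} r m⊥n t∣m t∣n with coprime-Bézout m⊥n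
  ... | Bézout.+- x y eq = bézout⇒∣r∸1 {t} {m} {n} {x} {y} r eq t∣m t∣n
  ... | Bézout.-+ x y eq = bézout⇒∣r∸1 {t} {n} {m} {y} {x} r eq t∣n t∣m

  gcd[r^m∸1,r^n∸1]≡r∸1 : ∀ {m n} r .{{_ : NonZero r}} → Coprime m n →
                          gcd (r ^ m ∸ 1) (r ^ n ∸ 1) ≡ r ∸ 1
  gcd[r^m∸1,r^n∸1]≡r∸1 {m} {n} r m⊥n = ∣-antisym
    (coprime⇒∣r^m∸1⇒∣r^n∸1⇒∣r∸1 r m⊥n (gcd[m,n]∣m (r ^ m ∸ 1) (r ^ n ∸ 1)) (gcd[m,n]∣n (r ^ m ∸ 1) (r ^ n ∸ 1)))
    (gcd-greatest (r∸1∣r^k∸1 r m) (r∸1∣r^k∸1 r n))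

  -- gcd (r^d − 1) (r^m − 1) = r − 1 turns lcm (r^d − 1) (r^m − 1) into M (r^m − 1); it divides
  -- r^(m d) − 1 = N (r^m − 1).
  geometricSum∣geometricSum[r^m] : ∀ {m d} r → 1 < r → 0 < m → Coprime m d →
                                   geometricSum r d ∣ geometricSum (r ^ m) d
  geometricSum∣geometricSum[r^m] {m} {d} r 1<r 0<m m⊥d =
    *-cancelˡ-∣ B {{>-nonZero B>0}} (subst (_∣ B * N) lcm≡B*M lcm∣B*N)
    where
    A = r ^ d ∸ 1
    B = r ^ m ∸ 1
    M = geometricSum r d
    N = geometricSum (r ^ m) d
    instance
      r≢0 : NonZero r
      r≢0 = >-nonZero (<-trans z<s 1<r)
      r∸1≢0 : NonZero (r ∸ 1)
      r∸1≢0 = >-nonZero (m<n⇒0<n∸m 1<r)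
    B>0 : 0 < B
    B>0 = m<n⇒0<n∸m (^-monoʳ-< r 1<r 0<m)
    B*N≡r^[m*d]∸1 : B * N ≡ r ^ (m * d) ∸ 1
    B*N≡r^[m*d]∸1 = trans (*-comm B N)
      (trans (geometricSum*[r∸1]≡r^k∸1 (r ^ m) d) (cong (_∸ 1) (^-*-assoc r m d)))
    lcm∣B*N : lcm A B ∣ B * N
    lcm∣B*N = subst (lcm A B ∣_) (sym B*N≡r^[m*d]∸1) (lcm-least
      (subst (λ k → A ∣ r ^ k ∸ 1) (*-comm d m) (r^m∸1∣r^[m*k]∸1 r d m))
      (r^m∸1∣r^[m*k]∸1 r m d))
    lcm≡B*M : lcm A B ≡ B * M
    lcm≡B*M = *-cancelˡ-≡ (lcm A B) (B * M) (r ∸ 1) (begin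
      (r ∸ 1) * lcm A B  ≡⟨ cong (_* lcm A B) (gcd[r^m∸1,r^n∸1]≡r∸1 r (Coprime.sym m⊥d)) ⟨
      gcd A B * lcm A B  ≡⟨ gcd*lcm A B ⟩
      A * B              ≡⟨ cong (_* B) (geometricSum*[r∸1]≡r^k∸1 r d) ⟨
      M * (r ∸ 1) * B    ≡⟨ rearrange M (r ∸ 1) B ⟩
      (r ∸ 1) * (B * M)  ∎)
      where
      open ≡-Reasoning
      rearrange : ∀ x y z → x * y * z ≡ y * (z * x)
      rearrange = solve-∀

  geometricSum-+ : ∀ r a b → geometricSum r (a + b) ≡ geometricSum r a + r ^ a * geometricSum r b
  geometricSum-+ r zero    b = sym (+-identityʳ (geometricSum r b))
  geometricSum-+ r (suc a) b = cong suc (trans (cong (r *_) (geometricSum-+ r a b))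
    (distrib r (geometricSum r a) (r ^ a) (geometricSum r b)))
    where
    distrib : ∀ r G x H → r * (G + x * H) ≡ r * G + r * x * H
    distrib = solve-∀

  geometricSum-* : ∀ r d m → geometricSum r (d * m) ≡ geometricSum (r ^ m) d * geometricSum r m
  geometricSum-* r zero    m = refl
  geometricSum-* r (suc d) m = begin
    geometricSum r (m + d * m)                                          ≡⟨ geometricSum-+ r m (d * m) ⟩
    geometricSum r m + r ^ m * geometricSum r (d * m)                   ≡⟨ cong (λ x → geometricSum r m + r ^ m * x) (geometricSum-* r d m) ⟩
    geometricSum r m + r ^ m * (geometricSum (r ^ m) d * geometricSum r m) ≡⟨ factor (geometricSum r m) (r ^ m) (geometricSum (r ^ m) d) ⟩
    suc (r ^ m * geometricSum (r ^ m) d) * geometricSum r m             ∎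
    where
    open ≡-Reasoning
    factor : ∀ G x H → G + x * (H * G) ≡ suc (x * H) * G
    factor = solve-∀

  k≤geometricSum : ∀ {r} k → 0 < r → k ≤ geometricSum r k
  k≤geometricSum zero    _   = z≤n
  k≤geometricSum {r} (suc k) 0<r = s≤s (≤-trans (k≤geometricSum k 0<r) (m≤n*m (geometricSum r k) r {{>-nonZero 0<r}}))

  k<geometricSum : ∀ {r} k → 1 < r → 1 < k → k < geometricSum r k
  k<geometricSum {r} (suc (suc k)) 1<r _           = begin-strict
    suc (suc k)                       <⟨ s≤s (m<m+n (suc k) z<s) ⟩
    suc (2 * suc k)                   ≤⟨ s≤s (*-mono-≤ 1<r (k≤geometricSum (suc k) (<-trans z<s 1<r))) ⟩
    suc (r * geometricSum r (suc k))  ∎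
    where open ≤-Reasoning
  k<geometricSum     (suc zero)    _   (s≤s ())

  [r^k∸1]/[r∸1]≡geometricSum : ∀ r k .{{_ : NonZero (r ∸ 1)}} → (r ^ k ∸ 1) / (r ∸ 1) ≡ geometricSum r k
  [r^k∸1]/[r∸1]≡geometricSum r k =
    trans (cong (_/ (r ∸ 1)) (sym (geometricSum*[r∸1]≡r^k∸1 r k))) (m*n/n≡m (geometricSum r k) (r ∸ 1))

  gcd-cofactors : ∀ {i e} → 0 < i → i < e →
    ∃[ g ] ∃[ i′ ] ∃[ d ] i ≡ i′ * g × e ≡ d * g × e ∣ i * d × Coprime i′ d × 0 < g × 0 < i′ × 1 < d
  gcd-cofactors {i} {e} 0<i i<e = g , i′ , d , i≡i′*g , e≡d*g , e∣i*d , i′⊥d , >-nonZero⁻¹ g , 0<i′ , 1<d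
    where
    g = gcd i e
    instance
      g≢0 : NonZero g
      g≢0 = ≢-nonZero (gcd[m,n]≢0 i e (inj₁ (m<n⇒n≢0 0<i)))
    open _∣_ (gcd[m,n]∣m i e) renaming (quotient to i′; equality to i≡i′*g)
    open _∣_ (gcd[m,n]∣n i e) renaming (quotient to d; equality to e≡d*g)
    i′⊥d : Coprime i′ d
    i′⊥d = subst₂ Coprime (n/m≡quotient (gcd[m,n]∣m i e)) (n/m≡quotient (gcd[m,n]∣n i e)) (coprime-/gcd i e)
    0<i′ : 0 < i′
    0<i′ = n≢0⇒n>0 λ i′≡0 → m<n⇒n≢0 0<i (trans i≡i′*g (cong (_* g) i′≡0))
    1<d : 1 < d
    1<d = ≰⇒> λ d≤1 → <⇒≱ i<e (begin
      e      ≡⟨ e≡d*g ⟩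
      d * g  ≤⟨ *-monoˡ-≤ g d≤1 ⟩
      1 * g  ≡⟨ *-identityˡ g ⟩
      g      ≤⟨ ∣⇒≤ {{>-nonZero 0<i}} (gcd[m,n]∣m i e) ⟩
      i      ∎)
      where open ≤-Reasoning
    e∣i*d : e ∣ i * d
    e∣i*d = divides i′ (begin
      i * d         ≡⟨ cong (_* d) i≡i′*g ⟩
      i′ * g * d    ≡⟨ rearrange i′ g d ⟩
      i′ * (d * g)  ≡⟨ cong (i′ *_) e≡d*g ⟨
      i′ * e        ∎)
      where
      open ≡-Reasoning
      rearrange : ∀ x y z → x * y * z ≡ x * (z * y)
      rearrange = solve-∀

  geometricSum-common-divisor : ∀ {p g i′} d → 1 < p → 0 < g → 0 < i′ → Coprime i′ d →
    geometricSum (p ^ g) d ∣ geometricSum p (d * g) × geometricSum (p ^ g) d ∣ geometricSum (p ^ (i′ * g)) d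
  geometricSum-common-divisor {p} {g} {i′} d 1<p 0<g 0<i′ i′⊥d =
      subst (M ∣_) (sym (geometricSum-* p d g)) (m∣m*n (geometricSum p g))
    , subst (λ x → M ∣ geometricSum x d) [p^g]^i′≡p^[i′*g]
        (geometricSum∣geometricSum[r^m] (p ^ g) (^-monoʳ-< p 1<p 0<g) 0<i′ i′⊥d)
    where
    M = geometricSum (p ^ g) d
    [p^g]^i′≡p^[i′*g] : (p ^ g) ^ i′ ≡ p ^ (i′ * g)
    [p^g]^i′≡p^[i′*g] = trans (^-*-assoc p g i′) (cong (p ^_) (*-comm g i′))

  short-multiple : ∀ {d M N n} → 0 < d → d < M → M ∣ N → M ∣ n → 0 < n →
                   ∃ λ s → n ∣ N * s × 0 < s * d × s * d < n
  short-multiple {d} {M} {N} {n} 0<d d<M (divides t N≡t*M) (divides s n≡s*M) 0<n =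
    s , divides t N*s≡t*n , >-nonZero⁻¹ (s * d) {{m*n≢0 s d}} , s*d<n
    where
    instance
      s≢0 : NonZero s
      s≢0 = m*n≢0⇒m≢0 s {{subst NonZero n≡s*M (>-nonZero 0<n)}}
      d≢0 : NonZero d
      d≢0 = >-nonZero 0<d
    N*s≡t*n : N * s ≡ t * n
    N*s≡t*n = begin
      N * s        ≡⟨ cong (_* s) N≡t*M ⟩
      t * M * s    ≡⟨ rearrange t M s ⟩
      t * (s * M)  ≡⟨ cong (t *_) n≡s*M ⟨
      t * n        ∎
      where
      open ≡-Reasoning
      rearrange : ∀ x y z → x * y * z ≡ x * (z * y)
      rearrange = solve-∀
    s*d<n : s * d < n
    s*d<n = subst (s * d <_) (sym n≡s*M) (*-monoʳ-< s d<M)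

  nontrivial-frobenius⇒short-period : ∀ {p i e n} → 1 < p → 0 < i → i < e → 0 < n → geometricSum p e ∣ n →
    ∃₂ λ d s → e ∣ i * d × n ∣ geometricSum (p ^ i) d * s × 0 < s * d × s * d < n
  nontrivial-frobenius⇒short-period {p} {i} {e} {n} 1<p 0<i i<e 0<n Gpe∣n =
    let g , i′ , d , i≡i′*g , e≡d*g , e∣i*d , i′⊥d , 0<g , 0<i′ , 1<d = gcd-cofactors 0<i i<e
        M = geometricSum (p ^ g) d
        M∣Gpe , M∣Gpi = geometricSum-common-divisor d 1<p 0<g 0<i′ i′⊥d
        s , n∣N*s , 0<s*d , s*d<n = short-multiple (<-trans z<s 1<d)
          (k<geometricSum d (^-monoʳ-< p 1<p 0<g) 1<d)
          (subst (λ x → M ∣ geometricSum (p ^ x) d) (sym i≡i′*g) M∣Gpi)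
          (∣-trans (subst (λ x → M ∣ geometricSum p x) (sym e≡d*g) M∣Gpe) Gpe∣n) 0<n
    in d , s , e∣i*d , n∣N*s , 0<s*d , s*d<n

iter-+ : ∀ {c} {B : Set c} (f : B → B) m k v → iter f (m ℕ.+ k) v ≡ iter f m (iter f k v)
iter-+ f ℕ.zero    k v = ≡.refl
iter-+ f (ℕ.suc m) k v = ≡.cong f (iter-+ f m k v)

iter-* : ∀ {c} {B : Set c} (f : B → B) k m v → iter f (k ℕ.* m) v ≡ iter (iter f m) k v
iter-* f ℕ.zero    m v = ≡.refl
iter-* f (ℕ.suc k) m v = ≡.trans (iter-+ f m (k ℕ.* m) v) (≡.cong (iter f m) (iter-* f k m v))

module FiniteFields {c ℓ : Level} (F : CommutativeRing c ℓ) (isField : IsField F) where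

  open CommutativeRing F
  open IsField isField
  open FieldDefs F
  open GeometricSums using (geometricSum)
  open RawSemiring (Semiring.rawSemiring semiring) using (_^_)
  open import Algebra.Properties.Semiring.Exp semiring using (^-assocʳ; ^-congˡ; ^-congʳ)
  open import Algebra.Properties.CommutativeSemiring.Exp commutativeSemiring using (^-distrib-*)
  open import Algebra.Properties.Semiring.Sum semiring using (*-distribʳ-sum; *-distribˡ-sum)
  open import Algebra.Properties.Monoid.Mult +-monoid using (_×_; ×-congʳ; ×-assocˡ)
  open import Algebra.Properties.Ring ring using ([y-z]x≈yx-zx; x[y-z]≈xy-xz)
  open import Algebra.Properties.Group +-group using (x∙y⁻¹≈ε⇒x≈y; x≈y⇒x∙y⁻¹≈ε; identityˡ-unique; ∙-cancelʳ)
  open import Relation.Binary.Reasoning.Setoid setoid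
  open import Algebra.Solver.Ring.NaturalCoefficients.Default commutativeSemiring using (solve; _:+_; _:*_; con; _:=_)
  module Σ = CommutativeMonoidSum +-commutativeMonoid
  module Π = CommutativeMonoidSum *-commutativeMonoid

  x*y≈0⇒y≈0 : ∀ {x y} → x ≉ 0# → x * y ≈ 0# → y ≈ 0#
  x*y≈0⇒y≈0 {x} {y} x≉0 xy≈0 with inverse x x≉0
  ... | x⁻¹ , xx⁻¹≈1 = begin
    y              ≈⟨ *-identityˡ y ⟨
    1# * y         ≈⟨ *-congʳ (trans (*-comm x⁻¹ x) xx⁻¹≈1) ⟨
    x⁻¹ * x * y    ≈⟨ *-assoc x⁻¹ x y ⟩
    x⁻¹ * (x * y)  ≈⟨ *-congˡ xy≈0 ⟩
    x⁻¹ * 0#       ≈⟨ zeroʳ x⁻¹ ⟩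
    0#             ∎

  *-≉0 : ∀ {x y} → x ≉ 0# → y ≉ 0# → x * y ≉ 0#
  *-≉0 x≉0 y≉0 xy≈0 = y≉0 (x*y≈0⇒y≈0 x≉0 xy≈0)

  *-cancelˡ-≉0 : ∀ {x y z} → x ≉ 0# → x * y ≈ x * z → y ≈ z
  *-cancelˡ-≉0 {x} {y} {z} x≉0 xy≈xz =
    x∙y⁻¹≈ε⇒x≈y y z (x*y≈0⇒y≈0 x≉0 (trans (x[y-z]≈xy-xz x y z) (x≈y⇒x∙y⁻¹≈ε xy≈xz)))

  1#^n≈1# : ∀ n → 1# ^ n ≈ 1#
  1#^n≈1# ℕ.zero    = refl
  1#^n≈1# (ℕ.suc n) = trans (*-identityˡ (1# ^ n)) (1#^n≈1# n)

  ^-comm : ∀ x m n → (x ^ m) ^ n ≈ (x ^ n) ^ m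
  ^-comm x m n = trans (^-assocʳ x m n) (trans (^-congʳ x (ℕ.*-comm m n)) (sym (^-assocʳ x n m)))

  x^n≈1⇒[x^k]^n≈1 : ∀ {x n} → x ^ n ≈ 1# → ∀ k → (x ^ k) ^ n ≈ 1#
  x^n≈1⇒[x^k]^n≈1 {x} {n} xⁿ≈1 k = trans (^-comm x k n) (trans (^-congˡ k xⁿ≈1) (1#^n≈1# k))

  x^n≈1⇒n∣m⇒x^m≈1 : ∀ {x n m} → x ^ n ≈ 1# → n ∣ m → x ^ m ≈ 1#
  x^n≈1⇒n∣m⇒x^m≈1 {x} {n} xⁿ≈1 (divides k m≡k*n) =
    trans (^-congʳ x m≡k*n) (trans (sym (^-assocʳ x k n)) (x^n≈1⇒[x^k]^n≈1 {x} {n} xⁿ≈1 k))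

  ∑-powers : ℕ.ℕ → Carrier → Carrier
  ∑-powers n x = Σ.sum {n} (λ j → x ^ toℕ j)

  ∑-powers-suc : ∀ n x → ∑-powers (ℕ.suc n) x ≈ 1# + x * ∑-powers n x
  ∑-powers-suc n x = +-congˡ (sym (*-distribˡ-sum {n} x (λ j → x ^ toℕ j)))

  x*∑-powers+1≈∑-powers+x^n : ∀ n x → x * ∑-powers n x + 1# ≈ ∑-powers n x + x ^ n
  x*∑-powers+1≈∑-powers+x^n ℕ.zero    x = +-congʳ (zeroʳ x)
  x*∑-powers+1≈∑-powers+x^n (ℕ.suc n) x = begin
    x * ∑-powers (ℕ.suc n) x + 1#  ≈⟨ +-congʳ (*-congˡ (∑-powers-suc n x)) ⟩
    x * (1# + x * S) + 1#          ≈⟨ solve 2 (λ x S → x :* (con 1 :+ x :* S) :+ con 1 := x :* (x :* S :+ con 1) :+ con 1) refl x S ⟩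
    x * (x * S + 1#) + 1#          ≈⟨ +-congʳ (*-congˡ (x*∑-powers+1≈∑-powers+x^n n x)) ⟩
    x * (S + x ^ n) + 1#           ≈⟨ solve 3 (λ x S y → x :* (S :+ y) :+ con 1 := (con 1 :+ x :* S) :+ x :* y) refl x S (x ^ n) ⟩
    (1# + x * S) + x * x ^ n       ≈⟨ +-congʳ (∑-powers-suc n x) ⟨
    ∑-powers (ℕ.suc n) x + x ^ ℕ.suc n ∎
    where S = ∑-powers n x

  ∑-powers-root≈0 : ∀ {n x} → x ^ n ≈ 1# → x ≉ 1# → ∑-powers n x ≈ 0#
  ∑-powers-root≈0 {n} {x} xⁿ≈1 x≉1 = x*y≈0⇒y≈0 (λ x-1≈0 → x≉1 (x∙y⁻¹≈ε⇒x≈y x 1# x-1≈0)) (begin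
    (x - 1#) * S      ≈⟨ [y-z]x≈yx-zx S x 1# ⟩
    x * S - 1# * S    ≈⟨ +-cong xS≈S (-‿cong (*-identityˡ S)) ⟩
    S - S             ≈⟨ -‿inverseʳ S ⟩
    0#                ∎)
    where
    S = ∑-powers n x
    xS≈S : x * S ≈ S
    xS≈S = ∙-cancelʳ 1# (x * S) S (trans (x*∑-powers+1≈∑-powers+x^n n x) (+-congˡ xⁿ≈1))

  ∑-powers-1 : ∀ n → ∑-powers n 1# ≈ n × 1#
  ∑-powers-1 n = trans (Σ.sum-cong-≋ {n} (λ j → 1#^n≈1# (toℕ j))) (Σ.sum-replicate n)

  record IsPrimitiveRoot (n : ℕ.ℕ) (a : Carrier) : Set ℓ where
    field
      root    : a ^ n ≈ 1#
      minimal : ∀ j → 0 ℕ.< j → j ℕ.< n → a ^ j ≉ 1#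

  -- only the term j = 0 survives
  ∑-powers-primitive≈n : ∀ {n a} → IsPrimitiveRoot n a → ∀ y →
                         Σ.sum {n} (λ j → ∑-powers n (a ^ toℕ j) * y ^ toℕ j) ≈ n × 1#
  ∑-powers-primitive≈n {ℕ.zero}      _           y = refl
  ∑-powers-primitive≈n {ℕ.suc m} {a} a-primitive y = begin
    ∑-powers n 1# * 1# + Σ.sum {m} (λ j → ∑-powers n (a ^ ℕ.suc (toℕ j)) * y ^ ℕ.suc (toℕ j))
      ≈⟨ +-cong (*-identityʳ _) (trans (Σ.sum-cong-≋ {m} vanishing) (Σ.sum-replicate-zero m)) ⟩
    ∑-powers n 1# + 0#  ≈⟨ +-identityʳ _ ⟩
    ∑-powers n 1#       ≈⟨ ∑-powers-1 n ⟩
    n × 1#              ∎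
    where
    open IsPrimitiveRoot a-primitive
    n = ℕ.suc m
    vanishing : ∀ j → ∑-powers n (a ^ ℕ.suc (toℕ j)) * y ^ ℕ.suc (toℕ j) ≈ 0#
    vanishing j = trans (*-congʳ (∑-powers-root≈0 {n} (x^n≈1⇒[x^k]^n≈1 {a} {n} root (ℕ.suc (toℕ j)))
                    (minimal (ℕ.suc (toℕ j)) (ℕ.s≤s ℕ.z≤n) (ℕ.s≤s (Fin.toℕ<n j))))) (zeroˡ _)

  ∑-powers-exchange : ∀ n a y → Σ.sum {n} (λ k → ∑-powers n (a ^ toℕ k * y))
                                ≈ Σ.sum {n} (λ j → ∑-powers n (a ^ toℕ j) * y ^ toℕ j)
  ∑-powers-exchange n a y = begin
    Σ.sum {n} (λ k → ∑-powers n (a ^ toℕ k * y))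
      ≈⟨ Σ.sum-cong-≋ {n} (λ k → Σ.sum-cong-≋ {n} (λ j → reorder k j)) ⟩
    Σ.sum {n} (λ k → Σ.sum {n} (λ j → (a ^ toℕ j) ^ toℕ k * y ^ toℕ j))
      ≈⟨ Σ.∑-comm {n} {n} (λ k j → (a ^ toℕ j) ^ toℕ k * y ^ toℕ j) ⟩
    Σ.sum {n} (λ j → Σ.sum {n} (λ k → (a ^ toℕ j) ^ toℕ k * y ^ toℕ j))
      ≈⟨ Σ.sum-cong-≋ {n} (λ j → *-distribʳ-sum {n} (y ^ toℕ j) (λ k → (a ^ toℕ j) ^ toℕ k)) ⟨
    Σ.sum {n} (λ j → ∑-powers n (a ^ toℕ j) * y ^ toℕ j)
      ∎
    where
    reorder : ∀ k j → (a ^ toℕ k * y) ^ toℕ j ≈ (a ^ toℕ j) ^ toℕ k * y ^ toℕ j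
    reorder k j = trans (^-distrib-* (a ^ toℕ k) y (toℕ j)) (*-congʳ (^-comm a (toℕ k) (toℕ j)))

  -- If b were an n-th root of unity outside ⟨a⟩, every aᵏ b⁻¹ would be one too and ≠ 1,
  -- so the left-hand side of ∑-powers-exchange (with y = b⁻¹) would vanish.
  non-power-root⇒n×1#≈0# : ∀ {n a b} → IsPrimitiveRoot n a → b ^ n ≈ 1# →
                           (∀ (k : Fin n) → b ≉ a ^ toℕ k) → n × 1# ≈ 0#
  non-power-root⇒n×1#≈0# {ℕ.zero}          _           _    _    = refl
  non-power-root⇒n×1#≈0# {ℕ.suc m} {a} {b} a-primitive bⁿ≈1 b≉aᵏ = begin
    n × 1#                                            ≈⟨ ∑-powers-primitive≈n a-primitive b⁻¹ ⟨
    Σ.sum {n} (λ j → ∑-powers n (a ^ toℕ j) * b⁻¹ ^ toℕ j)  ≈⟨ ∑-powers-exchange n a b⁻¹ ⟨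
    Σ.sum {n} (λ k → ∑-powers n (z k))                ≈⟨ Σ.sum-cong-≋ {n} (λ k → ∑-powers-root≈0 {n} (z-root k) (z≉1 k)) ⟩
    Σ.sum {n} (λ _ → 0#)                              ≈⟨ Σ.sum-replicate-zero n ⟩
    0#                                                ∎
    where
    open IsPrimitiveRoot a-primitive
    n = ℕ.suc m
    b⁻¹ = b ^ m
    z : Fin n → Carrier
    z k = a ^ toℕ k * b⁻¹
    z-root : ∀ k → z k ^ n ≈ 1#
    z-root k = trans (^-distrib-* (a ^ toℕ k) b⁻¹ n)
      (trans (*-cong (x^n≈1⇒[x^k]^n≈1 {a} {n} root (toℕ k)) (x^n≈1⇒[x^k]^n≈1 {b} {n} bⁿ≈1 m)) (*-identityʳ 1#))
    z≉1 : ∀ k → z k ≉ 1#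
    z≉1 k zₖ≈1 = b≉aᵏ k (begin
      b                          ≈⟨ *-identityʳ b ⟨
      b * 1#                     ≈⟨ *-congˡ zₖ≈1 ⟨
      b * (a ^ toℕ k * b⁻¹)      ≈⟨ solve 3 (λ x y w → x :* (y :* w) := y :* (x :* w)) refl b (a ^ toℕ k) b⁻¹ ⟩
      a ^ toℕ k * (b * b⁻¹)      ≈⟨ *-congˡ bⁿ≈1 ⟩
      a ^ toℕ k * 1#             ≈⟨ *-identityʳ (a ^ toℕ k) ⟩
      a ^ toℕ k                  ∎)

  iter-scaling : ∀ {f c} → (∀ v → f v ≈ c * v) → ∀ k v → iter f k v ≈ c ^ k * v
  iter-scaling         f≈c* ℕ.zero    v = sym (*-identityˡ v)
  iter-scaling {f} {c} f≈c* (ℕ.suc k) v = begin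
    f (iter f k v)   ≈⟨ f≈c* (iter f k v) ⟩
    c * iter f k v   ≈⟨ *-congˡ (iter-scaling f≈c* k v) ⟩
    c * (c ^ k * v)  ≈⟨ *-assoc c (c ^ k) v ⟨
    c * c ^ k * v    ∎

  iter-monomial : ∀ {g a P} → (∀ v → g v ≈ a * v ^ P) →
                  ∀ k v → iter g k v ≈ a ^ geometricSum P k * v ^ (P ℕ.^ k)
  iter-monomial             g≈av^P ℕ.zero    v = sym (trans (*-identityˡ (v * 1#)) (*-identityʳ v))
  iter-monomial {g} {a} {P} g≈av^P (ℕ.suc k) v = begin
    g (iter g k v)                                ≈⟨ g≈av^P (iter g k v) ⟩
    a * iter g k v ^ P                            ≈⟨ *-congˡ (^-congˡ P (iter-monomial g≈av^P k v)) ⟩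
    a * (a ^ N * v ^ Pᵏ) ^ P                      ≈⟨ *-congˡ (^-distrib-* (a ^ N) (v ^ Pᵏ) P) ⟩
    a * ((a ^ N) ^ P * (v ^ Pᵏ) ^ P)              ≈⟨ *-assoc a _ _ ⟨
    a * (a ^ N) ^ P * (v ^ Pᵏ) ^ P                ≈⟨ *-cong (*-congˡ (^-assocʳ a N P)) (^-assocʳ v Pᵏ P) ⟩
    a * a ^ (N ℕ.* P) * v ^ (Pᵏ ℕ.* P)            ≈⟨ *-cong (^-congʳ a (≡.cong ℕ.suc (ℕ.*-comm N P))) (^-congʳ v (ℕ.*-comm Pᵏ P)) ⟩
    a ^ geometricSum P (ℕ.suc k) * v ^ (P ℕ.^ ℕ.suc k) ∎
    where
    N  = geometricSum P k
    Pᵏ = P ℕ.^ k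

  bijection : (f f⁻¹ : Carrier → Carrier) → Congruent _≈_ _≈_ f → Congruent _≈_ _≈_ f⁻¹ →
              (∀ x → f (f⁻¹ x) ≈ x) → (∀ x → f⁻¹ (f x) ≈ x) → Inverse setoid setoid
  bijection f f⁻¹ f-cong f⁻¹-cong ff⁻¹ f⁻¹f = record
    { to        = f
    ; from      = f⁻¹
    ; to-cong   = f-cong
    ; from-cong = f⁻¹-cong
    ; inverse   = (λ {x} y≈f⁻¹x → trans (f-cong y≈f⁻¹x) (ff⁻¹ x))
                , (λ {x} y≈fx → trans (f⁻¹-cong y≈fx) (f⁻¹f x))
    }

  translation : Carrier → Inverse setoid setoid
  translation u = bijection (u +_) (- u +_) +-congˡ +-congˡ (cancel u (- u) (-‿inverseʳ u)) (cancel (- u) u (-‿inverseˡ u))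
    where
    cancel : ∀ u w → u + w ≈ 0# → ∀ x → u + (w + x) ≈ x
    cancel u w u+w≈0 x = trans (sym (+-assoc u w x)) (trans (+-congʳ u+w≈0) (+-identityˡ x))

  scaling : ∀ {u} → u ≉ 0# → Inverse setoid setoid
  scaling {u} u≉0 with inverse u u≉0
  ... | u⁻¹ , uu⁻¹≈1 = bijection (u *_) (u⁻¹ *_) *-congˡ *-congˡ (cancel u u⁻¹ uu⁻¹≈1) (cancel u⁻¹ u (trans (*-comm u⁻¹ u) uu⁻¹≈1))
    where
    cancel : ∀ u w → u * w ≈ 1# → ∀ x → u * (w * x) ≈ x
    cancel u w uw≈1 x = trans (sym (*-assoc u w x)) (trans (*-congʳ uw≈1) (*-identityˡ x))

  module Finite {q : ℕ.ℕ} (card : HasCard F q) where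

    open Inverse card using (to; from; strictlyInverseʳ)

    infix 4 _≟_
    _≟_ : Decidable _≈_
    _≟_ = via-injection (Inverse⇒Injection card) Fin._≟_

    module _ {a ℓ′} (M : CommutativeMonoid a ℓ′) where
      private module M = CommutativeMonoid M
      open CommutativeMonoidSum M using (sum; ∑-permute; sum-cong-≋)

      sum-invariant : (h : Carrier → M.Carrier) → Congruent _≈_ M._≈_ h → (φ : Inverse setoid setoid) →
                      M._≈_ (sum (λ i → h (from i))) (sum (λ i → h (Inverse.to φ (from i))))
      sum-invariant h h-cong φ = M.trans (∑-permute (h ∘ from) π)
        (sum-cong-≋ (λ i → h-cong (strictlyInverseʳ (Inverse.to φ (from i)))))
        where
        π : Permutation q q
        π = Compose.inverse (Symmetry.inverse card) (Compose.inverse φ card)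

    q×1#≈0# : q × 1# ≈ 0#
    q×1#≈0# = identityˡ-unique (q × 1#) S (sym (begin
      S                                ≈⟨ sum-invariant +-commutativeMonoid (λ v → v) (λ v≈w → v≈w) (translation 1#) ⟩
      Σ.sum {q} (λ i → 1# + from i)    ≈⟨ Σ.∑-distrib-+ {q} (λ _ → 1#) from ⟩
      Σ.sum {q} (λ _ → 1#) + S         ≈⟨ +-congʳ (Σ.sum-replicate q) ⟩
      q × 1# + S                       ∎))
      where
      S = Σ.sum {q} from

    n∣q∸1⇒n×1#≉0# : ∀ {n} → n ∣ q ℕ.∸ 1 → n × 1# ≉ 0#
    n∣q∸1⇒n×1#≉0# {n} (divides t q∸1≡t*n) n×1#≈0# = 0≉1 (sym (begin
      1#                          ≈⟨ +-identityʳ 1# ⟨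
      1# + 0#                     ≈⟨ +-congˡ (t×0#≈0# t) ⟨
      1# + t × 0#                 ≈⟨ +-congˡ (×-congʳ t n×1#≈0#) ⟨
      1# + t × (n × 1#)           ≈⟨ +-congˡ (×-assocˡ 1# t n) ⟩
      ℕ.suc (t ℕ.* n) × 1#        ≡⟨ ≡.cong (_× 1#) q≡1+t*n ⟨
      q × 1#                      ≈⟨ q×1#≈0# ⟩
      0#                          ∎))
      where
      instance
        q≢0 : ℕ.NonZero q
        q≢0 = Fin.nonZeroIndex (to 0#)
      q≡1+t*n : q ≡ ℕ.suc (t ℕ.* n)
      q≡1+t*n = ≡.trans (≡.sym (ℕ.suc-pred q)) (≡.cong ℕ.suc q∸1≡t*n)
      t×0#≈0# : ∀ t → t × 0# ≈ 0#
      t×0#≈0# ℕ.zero    = refl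
      t×0#≈0# (ℕ.suc t) = trans (+-identityˡ (t × 0#)) (t×0#≈0# t)

    0↦1 : Carrier → Carrier
    0↦1 v with v ≟ 0#
    ... | yes _ = 1#
    ... | no  _ = v

    0↦1-≉0 : ∀ v → 0↦1 v ≉ 0#
    0↦1-≉0 v with v ≟ 0#
    ... | yes _   = λ 1≈0 → 0≉1 (sym 1≈0)
    ... | no  v≉0 = v≉0

    0↦1-zero : ∀ {v} → v ≈ 0# → 0↦1 v ≈ 1#
    0↦1-zero {v} v≈0 with v ≟ 0#
    ... | yes _   = refl
    ... | no  v≉0 = contradiction v≈0 v≉0

    0↦1-nonzero : ∀ {v} → v ≉ 0# → 0↦1 v ≈ v
    0↦1-nonzero {v} v≉0 with v ≟ 0#
    ... | yes v≈0 = contradiction v≈0 v≉0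
    ... | no  _   = refl

    0↦1-cong : Congruent _≈_ _≈_ 0↦1
    0↦1-cong {v} {w} v≈w = by-cases (w ≟ 0#)
      where
      by-cases : Dec (w ≈ 0#) → 0↦1 v ≈ 0↦1 w
      by-cases (yes w≈0) = trans (0↦1-zero (trans v≈w w≈0)) (sym (0↦1-zero w≈0))
      by-cases (no  w≉0) = trans (0↦1-nonzero (λ v≈0 → w≉0 (trans (sym v≈w) v≈0))) (trans v≈w (sym (0↦1-nonzero w≉0)))

    ∏-≉0 : ∀ {n} (u : Fin n → Carrier) → (∀ i → u i ≉ 0#) → Π.sum u ≉ 0#
    ∏-≉0 {ℕ.zero}  u u≉0 = λ 1≈0 → 0≉1 (sym 1≈0)
    ∏-≉0 {ℕ.suc n} u u≉0 = *-≉0 (u≉0 Fin.zero) (∏-≉0 (u ∘ Fin.suc) (u≉0 ∘ Fin.suc))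

    ∏-update : ∀ {n} (u w : Fin n → Carrier) j z → (∀ i → i ≢ j → u i ≈ w i) → u j ≈ z * w j →
               Π.sum u ≈ z * Π.sum w
    ∏-update {ℕ.suc n} u w j z uᵢ≈wᵢ uⱼ≈zwⱼ = begin
      Π.sum u                                ≈⟨ Π.sum-remove {i = j} u ⟩
      u j * Π.sum (removeAt u j)             ≈⟨ *-cong uⱼ≈zwⱼ (Π.sum-cong-≋ {n} (λ k → uᵢ≈wᵢ (Fin.punchIn j k) (Fin.punchInᵢ≢i j k))) ⟩
      z * w j * Π.sum (removeAt w j)         ≈⟨ *-assoc z (w j) _ ⟩
      z * (w j * Π.sum (removeAt w j))       ≈⟨ *-congˡ (Π.sum-remove {i = j} w) ⟨
      z * Π.sum w                            ∎

    -- v ↦ x v permutes F, so P := ∏ᵥ 0↦1 v = ∏ᵥ 0↦1 (x v); and x^q P = ∏ᵥ x · 0↦1 v differs from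
    -- the latter product only at v = 0, by a factor x.  Hence x^q P = x P with P ≠ 0.
    x^q≈x : ∀ x → x ^ q ≈ x
    x^q≈x x with x ≟ 0#
    ... | yes x≈0 = trans (^-congˡ q x≈0) (trans (0#^n≈0# q {{Fin.nonZeroIndex (to 0#)}}) (sym x≈0))
      where
      0#^n≈0# : ∀ n .{{_ : ℕ.NonZero n}} → 0# ^ n ≈ 0#
      0#^n≈0# (ℕ.suc n) = zeroˡ (0# ^ n)
    ... | no  x≉0 = *-cancelˡ-≉0 (∏-≉0 (0↦1 ∘ from) (0↦1-≉0 ∘ from)) (begin
      P * x ^ q                               ≈⟨ *-comm P (x ^ q) ⟩
      x ^ q * P                               ≈⟨ *-congʳ (Π.sum-replicate q) ⟨
      Π.sum {q} (λ _ → x) * P                 ≈⟨ Π.∑-distrib-+ {q} (λ _ → x) (0↦1 ∘ from) ⟨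
      Π.sum {q} (λ i → x * 0↦1 (from i))      ≈⟨ ∏-update _ _ (to 0#) x scale-nonzero scale-zero ⟩
      x * Π.sum {q} (λ i → 0↦1 (x * from i))  ≈⟨ *-congˡ (sum-invariant *-commutativeMonoid 0↦1 0↦1-cong (scaling x≉0)) ⟨
      x * P                                   ≈⟨ *-comm x P ⟩
      P * x                                   ∎)
      where
      P = Π.sum {q} (0↦1 ∘ from)
      scale-nonzero : ∀ i → i ≢ to 0# → x * 0↦1 (from i) ≈ 0↦1 (x * from i)
      scale-nonzero i i≢0 = trans (*-congˡ (0↦1-nonzero vᵢ≉0)) (sym (0↦1-nonzero (*-≉0 x≉0 vᵢ≉0)))
        where
        vᵢ≉0 : from i ≉ 0#
        vᵢ≉0 vᵢ≈0 = i≢0 (≡.trans (≡.sym (Inverse.strictlyInverseˡ card i)) (Inverse.to-cong card vᵢ≈0))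
      scale-zero : x * 0↦1 (from (to 0#)) ≈ x * 0↦1 (x * from (to 0#))
      scale-zero = *-congˡ (trans (0↦1-zero v₀≈0) (sym (0↦1-zero (trans (*-congˡ v₀≈0) (zeroʳ x)))))
        where
        v₀≈0 : from (to 0#) ≈ 0#
        v₀≈0 = strictlyInverseʳ 0#

    x^[q^k]≈x : ∀ k x → x ^ (q ℕ.^ k) ≈ x
    x^[q^k]≈x ℕ.zero    x = *-identityʳ x
    x^[q^k]≈x (ℕ.suc k) x = begin
      x ^ (q ℕ.* q ℕ.^ k)   ≈⟨ ^-assocʳ x q (q ℕ.^ k) ⟨
      (x ^ q) ^ (q ℕ.^ k)   ≈⟨ ^-congˡ (q ℕ.^ k) (x^q≈x x) ⟩
      x ^ (q ℕ.^ k)         ≈⟨ x^[q^k]≈x k x ⟩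
      x                     ∎

    primitive-root-generates : ∀ {n a b} → n ∣ q ℕ.∸ 1 → IsPrimitiveRoot n a → b ^ n ≈ 1# → ∃ λ k → b ≈ a ^ k
    primitive-root-generates {n} {a} {b} n∣q∸1 a-primitive bⁿ≈1 with Fin.any? (λ (k : Fin n) → b ≟ a ^ toℕ k)
    ... | yes (k , b≈aᵏ) = toℕ k , b≈aᵏ
    ... | no  ∄k         = contradiction (non-power-root⇒n×1#≈0# a-primitive bⁿ≈1 (λ k b≈aᵏ → ∄k (k , b≈aᵏ)))
                                         (n∣q∸1⇒n×1#≉0# n∣q∸1)

    scaling-generatesD : ∀ {n g a} → n ∣ q ℕ.∸ 1 → InS n a → HasOrder g n → (∀ v → g v ≈ a * v) → GeneratesD n g
    scaling-generatesD {n} {g} {a} n∣q∸1 aⁿ≈1 (_ , _ , minimal) g≈a* = (a , aⁿ≈1 , g≈a*) , generates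
      where
      a-primitive : IsPrimitiveRoot n a
      a-primitive = record
        { root    = aⁿ≈1
        ; minimal = λ j 0<j j<n aʲ≈1 → minimal j 0<j j<n
                      (λ v → trans (iter-scaling g≈a* j v) (trans (*-congʳ aʲ≈1) (*-identityˡ v)))
        }
      generates : ∀ h → InD n h → ∃ λ k → h ≋ iter g k
      generates h (b , bⁿ≈1 , h≈b*) =
        let k , b≈aᵏ = primitive-root-generates n∣q∸1 a-primitive bⁿ≈1
        in  k , λ v → trans (h≈b* v) (trans (*-congʳ b≈aᵏ) (sym (iter-scaling g≈a* k v)))

  H0map-power≋id : ∀ {p e n a i g d s} → HasCard F (p ℕ.^ e) → InS n a → g ≋ H0map p a i →
                     e ∣ i ℕ.* d → n ∣ geometricSum (p ℕ.^ i) d ℕ.* s → iter g (s ℕ.* d) ≋ (λ v → v)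
  H0map-power≋id {p} {e} {n} {a} {i} {g} {d} {s} card aⁿ≈1 g≋ (divides j i*d≡j*e) n∣N*s v = begin
    iter g (s ℕ.* d) v     ≡⟨ iter-* g s d v ⟩
    iter (iter g d) s v    ≈⟨ iter-scaling gᵈ≈aᴺ* s v ⟩
    (a ^ N) ^ s * v        ≈⟨ *-congʳ (^-assocʳ a N s) ⟩
    a ^ (N ℕ.* s) * v      ≈⟨ *-congʳ (x^n≈1⇒n∣m⇒x^m≈1 {a} {n} aⁿ≈1 n∣N*s) ⟩
    1# * v                 ≈⟨ *-identityˡ v ⟩
    v                      ∎
    where
    open Finite card using (x^[q^k]≈x)
    N = geometricSum (p ℕ.^ i) d
    [p^i]^d≡[p^e]^j : (p ℕ.^ i) ℕ.^ d ≡ (p ℕ.^ e) ℕ.^ j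
    [p^i]^d≡[p^e]^j = ≡.trans (ℕ.^-*-assoc p i d)
      (≡.trans (≡.cong (p ℕ.^_) (≡.trans i*d≡j*e (ℕ.*-comm j e))) (≡.sym (ℕ.^-*-assoc p e j)))
    gᵈ≈aᴺ* : ∀ v → iter g d v ≈ a ^ N * v
    gᵈ≈aᴺ* v = trans (iter-monomial g≋ d v) (*-congˡ (trans (^-congʳ v [p^i]^d≡[p^e]^j) (x^[q^k]≈x j v)))

open import Data.Nat using (ℕ; _<_; _∸_; _^_; _/_; zero; suc; _*_; z<s; nonTrivial⇒n>1)
open GeometricSums using (geometricSum; [r^k∸1]/[r∸1]≡geometricSum; nontrivial-frobenius⇒short-period)

lemma4p2 : ∀ {c ℓ : Level} (F : CommutativeRing c ℓ) → IsField F →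
    (p e n : ℕ) (pp : Prime p) →
    HasCard F (p ^ e) →
    0 < n → n ∣ (p ^ e) ∸ 1 →
    (2 < p → 2 ∣ n) →
    MultOrder p n e →
    _/_ ((p ^ e) ∸ 1) (p ∸ 1) {{prime⇒pred-nonZero pp}} ∣ n →
    (g : CommutativeRing.Carrier F → CommutativeRing.Carrier F) →
    FieldDefs.InH0 F p e n g → FieldDefs.HasOrder F g n →
    FieldDefs.GeneratesD F n g
lemma4p2 F isF p e n pp card _ n∣q∸1 _ _ _ g (a , zero , aⁿ≈1 , _ , g≋) g-order =
  scaling-generatesD n∣q∸1 aⁿ≈1 g-order (λ v → trans (g≋ v) (*-congˡ (*-identityʳ v)))
  where
  open CommutativeRing F using (trans; *-congˡ; *-identityʳ)
  open FiniteFields F isF using (module Finite)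
  open Finite card using (scaling-generatesD)
lemma4p2 F isF p e n pp card 0<n _ _ _ L∣n g (a , suc i , aⁿ≈1 , i<e , g≋) (_ , _ , minimal) =
  let d , s , e∣i*d , n∣N*s , 0<s*d , s*d<n = nontrivial-frobenius⇒short-period 1<p z<s i<e 0<n Gpe∣n
  in  ⊥-elim (minimal (s * d) 0<s*d s*d<n (FiniteFields.H0map-power≋id F isF {i = suc i} {d = d} {s = s} card aⁿ≈1 g≋ e∣i*d n∣N*s))
  where
  1<p : 1 < p
  1<p = nonTrivial⇒n>1 p {{prime⇒nonTrivial pp}}
  Gpe∣n : geometricSum p e ∣ n
  Gpe∣n = ≡.subst (_∣ n) ([r^k∸1]/[r∸1]≡geometricSum p e {{prime⇒pred-nonZero pp}}) L∣n
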